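{- Let $\sigma=\sigma_1\mathbf{s}^M\sigma_2$ and $\sigma'=\sigma_1\mathbf{s}^{M'}\sigma_2$ be elements of $(2^{\mathrm{AT}})^\omega$, where $\sigma_1$ is a finite word, $\mathbf{s}$ a nonempty finite word and $\sigma_2$ an $\omega$-word over $2^{\mathrm{AT}}$, and let $i,i'\in\mathbb{N}$ and $N\ge 2$ be such that $M,M'\ge 2N+1$ and $(\sigma,i)\equiv_N(\sigma',i')$. Then for every $\mathrm{PLTL}[\emptyset]$ formula $\varphi$ with temporal depth at most $N$, we have $\sigma,i\models\varphi$ iff $\sigma',i'\models\varphi$.
   Context: $\mathrm{PLTL}[\emptyset]$ formulae: $\varphi::=p\mid\neg\varphi\mid\varphi\wedge\varphi\mid\varphi\vee\varphi\mid\mathtt{X}\varphi\mid\varphi\mathtt{U}\varphi\mid\mathtt{X}^{ -1}\varphi\mid\varphi\mathtt{S}\varphi$ with $p\in\mathrm{AT}$, interpreted over $\sigma\in(2^{\mathrm{AT}})^\omega$: $\sigma,i\models p$ iff $p\in\sigma(i)$; $\sigma,i\models\mathtt{X}\varphi$ iff $\sigma,i+1\models\varphi$; $\sigma,i\models\varphi_1\mathtt{U}\varphi_2$ iff some $j\ge i$ has $\sigma,j\models\varphi_2$ and $\sigma,k\models\varphi_1$ for $i\le k<j$; $\sigma,i\models\mathtt{X}^{ -1}\varphi$ iff $i>0$ and $\sigma,i-1\models\varphi$; $\sigma,i\models\varphi_1\mathtt{S}\varphi_2$ iff some $0\le j\le i$ has $\sigma,j\models\varphi_2$ and $\sigma,k\models\varphi_1$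 for $j<k\le i$. The temporal depth of $\varphi$ is the maximal nesting of temporal operators in $\varphi$. For $M,M',N\in\mathbb{N}$, $M\approx_N M'$ iff $\min(M,N)=\min(M',N)$. For $w=w_1u^Mw_2$, $w'=w_1u^{M'}w_2$ ($w_1$ finite, $u$ nonempty finite, $w_2$ infinite; $|x|$ is length) and $i,i'\in\mathbb{N}$, $(w,i)\equiv_N(w',i')$ iff $M\approx_{2N}M'$ and one of: (1) $i,i'<|w_1|+N|u|$ and $i=i'$; (2) $i\ge|w_1|+(M-N)|u|$, $i'\ge|w_1|+(M'-N)|u|$ and $i-i'=(M-M')|u|$; (3) $|w_1|+N|u|\le i<|w_1|+(M-N)|u|$, $|w_1|+N|u|\le i'<|w_1|+(M'-N)|u|$ and $|i-i'|\equiv 0 \bmod |u|$. -}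

module Defs where

open import Data.Nat using (ℕ; zero; suc; _+_; _*_; _∸_; _≤_; _<_; _⊔_; _⊓_; ∣_-_∣)
open import Data.Nat.Divisibility using (_∣_)
open import Data.Bool using (Bool; true)
open import Data.List using (List; []; _∷_; length; _++_)
open import Data.Product using (Σ; ∃; _×_; _,_)
open import Data.Sum using (_⊎_)
open import Relation.Binary.PropositionalEquality using (_≡_)

data Formula (AT : Set) : Set where
  atom  : AT → Formula AT
  ¬ᶠ_   : Formula AT → Formula AT
  _∧ᶠ_  : Formula AT → Formula AT → Formula AT
  _∨ᶠ_  : Formula AT → Formula AT → Formula AT
  X     : Formula AT → Formula AT
  _U_   : Formula AT → Formula AT → Formula AT
  X⁻¹   : Formula AT → Formula AT
  _S_   : Formula AT → Formula AT → Formula AT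

-- A letter of 2^AT is a subset of AT, given by its characteristic function.
Letter : Set → Set
Letter AT = AT → Bool

ωWord : Set → Set
ωWord A = ℕ → A

_,_⊨_ : {AT : Set} → ωWord (Letter AT) → ℕ → Formula AT → Set
σ , i ⊨ atom p = σ i p ≡ true
σ , i ⊨ (¬ᶠ φ) = σ , i ⊨ φ → ⊥' where open import Data.Empty renaming (⊥ to ⊥')
σ , i ⊨ (φ ∧ᶠ ψ) = (σ , i ⊨ φ) × (σ , i ⊨ ψ)
σ , i ⊨ (φ ∨ᶠ ψ) = (σ , i ⊨ φ) ⊎ (σ , i ⊨ ψ)
σ , i ⊨ X φ = σ , suc i ⊨ φ
σ , i ⊨ (φ U ψ) = Σ ℕ λ j → (i ≤ j) × (σ , j ⊨ ψ) × ((k : ℕ) → i ≤ k → k < j → σ , k ⊨ φ)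
σ , zero ⊨ X⁻¹ φ = ⊥' where open import Data.Empty renaming (⊥ to ⊥')
σ , suc i ⊨ X⁻¹ φ = σ , i ⊨ φ
σ , i ⊨ (φ S ψ) = Σ ℕ λ j → (j ≤ i) × (σ , j ⊨ ψ) × ((k : ℕ) → j < k → k ≤ i → σ , k ⊨ φ)

td : {AT : Set} → Formula AT → ℕ
td (atom p) = 0
td (¬ᶠ φ) = td φ
td (φ ∧ᶠ ψ) = td φ ⊔ td ψ
td (φ ∨ᶠ ψ) = td φ ⊔ td ψ
td (X φ) = suc (td φ)
td (φ U ψ) = suc (td φ ⊔ td ψ)
td (X⁻¹ φ) = suc (td φ)
td (φ S ψ) = suc (td φ ⊔ td ψ)

_++ω_ : {A : Set} → List A → ωWord A → ωWord A
([] ++ω w) n = w n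
((a ∷ u) ++ω w) zero = a
((a ∷ u) ++ω w) (suc n) = (u ++ω w) n

_^ʷ_ : {A : Set} → List A → ℕ → List A
u ^ʷ zero = []
u ^ʷ suc M = u ++ (u ^ʷ M)

_≈⟨_⟩_ : ℕ → ℕ → ℕ → Set
M ≈⟨ N ⟩ M' = M ⊓ N ≡ M' ⊓ N

-- (w1 u^M w2 , i) ≡_N (w1 u^M' w2 , i')
-- (the condition i - i' = (M - M')|u| of case (2) is written additively in ℕ)
Equiv : {A : Set} (w₁ u : List A) (M M' N i i' : ℕ) → Set
Equiv w₁ u M M' N i i' =
  (M ≈⟨ 2 * N ⟩ M') ×
  ( ((i < length w₁ + N * length u) × (i' < length w₁ + N * length u) × (i ≡ i'))
  ⊎ ( (length w₁ + (M ∸ N) * length u ≤ i)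
    × (length w₁ + (M' ∸ N) * length u ≤ i')
    × (i + M' * length u ≡ i' + M * length u))
  ⊎ ( (length w₁ + N * length u ≤ i) × (i < length w₁ + (M ∸ N) * length u)
    × (length w₁ + N * length u ≤ i') × (i' < length w₁ + (M' ∸ N) * length u)
    × (length u ∣ ∣ i - i' ∣)))

module Submission where

-- An Ehrenfeucht–Fraïssé argument.  A level-indexed relation between the
-- positions of two ω-words is a *game* if related positions carry the same
-- letter and every move of X, X⁻¹, U, S from positions related at level n+1
-- can be answered by positions related at level n; by induction on formulae,
-- positions related at level n then agree on all formulae of temporal depth
-- ≤ n (`adequacy`).  For σ_M = σ₁ s^M σ₂ (L = |σ₁|, p = |s|, M = K + n) the
-- level-n relation `Match n K K'` splits positions into a left zone below
-- L+np (matched identically), a right zone from L+Kp (matched by offset) and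
-- a middle zone between (matched modulo p).  The theorem
-- is adequacy of that game at level N.

open import Defs
open import Data.Nat using (ℕ; _≤_; _*_; _+_)
open import Data.List using (List; [])
open import Function.Bundles using (_⇔_)
open import Relation.Binary.PropositionalEquality using (_≢_)

open import Data.Nat using (zero; suc; _∸_; _<_; _≤?_; _<?_; z≤n; s≤s; s≤s⁻¹; NonZero; ∣_-_∣)
open import Data.Nat.Properties
open import Data.Nat.DivMod using (_%_; _/_; m≡m%n+[m/n]*n; m%n<n; m%n≤m; [m+kn]%n≡m%n; m<n*o⇒m/o<n)
open import Data.Nat.Divisibility using (_∣_; divides)
open import Data.Nat.Tactic.RingSolver using (solve-∀)
open import Data.List using (_∷_; length; _++_)
open import Data.Product using (Σ; _×_; _,_)
open import Data.Sum using (inj₁; inj₂)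
open import Data.Empty using (⊥-elim)
open import Relation.Nullary using (yes; no)
open import Relation.Binary.PropositionalEquality
  using (_≡_; refl; sym; trans; cong; subst; subst₂; module ≡-Reasoning)
open import Function.Bundles using (mk⇔)

split-off : ∀ {e x} → e ≤ x → Σ ℕ λ y → y + e ≡ x
split-off {e} {x} e≤x = x ∸ e , m∸n+n≡m e≤x

module Congruence (p : ℕ) where

  infix 4 _≋_
  _≋_ : ℕ → ℕ → Set
  x ≋ y = Σ ℕ λ a → Σ ℕ λ b → x + a * p ≡ y + b * p

  ≋-refl : ∀ {x} → x ≋ x
  ≋-refl = 0 , 0 , refl

  ≋-sym : ∀ {x y} → x ≋ y → y ≋ x
  ≋-sym (a , b , eq) = b , a , sym eq

  ≋-trans : ∀ {x y z} → x ≋ y → y ≋ z → x ≋ z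
  ≋-trans {x} {y} {z} (a , b , x≋y) (c , d , y≋z) = a + c , d + b , (begin
    x + (a + c) * p   ≡⟨ regroup x a c p ⟩
    x + a * p + c * p ≡⟨ cong (_+ c * p) x≋y ⟩
    y + b * p + c * p ≡⟨ swap y b c p ⟩
    y + c * p + b * p ≡⟨ cong (_+ b * p) y≋z ⟩
    z + d * p + b * p ≡⟨ sym (regroup z d b p) ⟩
    z + (d + b) * p   ∎)
    where
    open ≡-Reasoning
    regroup : ∀ x a c p → x + (a + c) * p ≡ x + a * p + c * p
    regroup = solve-∀
    swap : ∀ y b c p → y + b * p + c * p ≡ y + c * p + b * p
    swap = solve-∀

  ≋-+ˡ : ∀ c {x y} → x ≋ y → c + x ≋ c + y
  ≋-+ˡ c {x} {y} (a , b , eq) =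
    a , b , trans (+-assoc c x (a * p)) (trans (cong (c +_) eq) (sym (+-assoc c y (b * p))))

  ≋-cancelˡ : ∀ c {x y} → c + x ≋ c + y → x ≋ y
  ≋-cancelˡ c {x} {y} (a , b , eq) =
    a , b , +-cancelˡ-≡ c _ _ (trans (sym (+-assoc c x (a * p))) (trans eq (+-assoc c y (b * p))))

  ≋-+ʳ : ∀ c {x y} → x ≋ y → x + c ≋ y + c
  ≋-+ʳ c {x} {y} x≋y = subst₂ _≋_ (+-comm c x) (+-comm c y) (≋-+ˡ c x≋y)

  ≋-cancelʳ : ∀ c {x y} → x + c ≋ y + c → x ≋ y
  ≋-cancelʳ c {x} {y} x+c≋y+c = ≋-cancelˡ c (subst₂ _≋_ (+-comm x c) (+-comm y c) x+c≋y+c)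

  ≋⇒%≡ : .{{_ : NonZero p}} → ∀ {x y} → x ≋ y → x % p ≡ y % p
  ≋⇒%≡ {x} {y} (a , b , eq) =
    trans (sym ([m+kn]%n≡m%n x a p)) (trans (cong (_% p) eq) ([m+kn]%n≡m%n y b p))

  %-≋ : .{{_ : NonZero p}} → ∀ x → x % p ≋ x
  %-≋ x = x / p , 0 , trans (sym (m≡m%n+[m/n]*n x p)) (sym (+-identityʳ x))

  ∣-∣⇒≋ : ∀ {x y} → p ∣ ∣ x - y ∣ → x ≋ y
  ∣-∣⇒≋ {x} {y} (divides q dist≡qp) with ≤-total x y
  ... | inj₁ x≤y = q , 0 , (begin
    x + q * p       ≡⟨ cong (x +_) (sym (trans (sym (m≤n⇒∣m-n∣≡n∸m x≤y)) dist≡qp)) ⟩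
    x + (y ∸ x)     ≡⟨ m+[n∸m]≡n x≤y ⟩
    y               ≡⟨ sym (+-identityʳ y) ⟩
    y + 0 * p       ∎)
    where open ≡-Reasoning
  ... | inj₂ y≤x = ≋-sym (q , 0 , (begin
    y + q * p       ≡⟨ cong (y +_) (sym (trans (sym (m≤n⇒∣n-m∣≡n∸m y≤x)) dist≡qp)) ⟩
    y + (x ∸ y)     ≡⟨ m+[n∸m]≡n y≤x ⟩
    x               ≡⟨ sym (+-identityʳ x) ⟩
    x + 0 * p       ∎))
    where open ≡-Reasoning

-- Spoiler picks j ≥ i (resp. j ≤ i) in σ;
-- Duplicator answers j' ≥ i' (resp. j' ≤ i') in σ' such that j and j' are
-- related and every k' in [i', j') (resp. (j', i']) is related to some k in
-- [i, j) (resp. (j, i]).  These are exactly what the clauses of U and S need.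
UntilAnswer : (R : ℕ → ℕ → Set) (i i' j j' : ℕ) → Set
UntilAnswer R i i' j j' = i' ≤ j' × R j j'
  × (∀ k' → i' ≤ k' → k' < j' → Σ ℕ λ k → i ≤ k × k < j × R k k')

SinceAnswer : (R : ℕ → ℕ → Set) (i i' j j' : ℕ) → Set
SinceAnswer R i i' j j' = j' ≤ i' × R j j'
  × (∀ k' → j' < k' → k' ≤ i' → Σ ℕ λ k → j < k × k ≤ i × R k k')

module _ {R : ℕ → ℕ → Set} where

  until-then : ∀ {i i' j₁ j₁' j j'} → UntilAnswer R i i' j₁ j₁' → UntilAnswer R j₁ j₁' j j'
    → i ≤ j₁ → j₁ ≤ j → UntilAnswer R i i' j j'
  until-then {i} {i'} {j₁' = j₁'} {j} {j'} (i'≤j₁' , _ , cover₁) (j₁'≤j' , rj , cover₂) i≤j₁ j₁≤j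
    = ≤-trans i'≤j₁' j₁'≤j' , rj , cover
    where
    cover : ∀ k' → i' ≤ k' → k' < j' → Σ ℕ λ k → i ≤ k × k < j × R k k'
    cover k' i'≤k' k'<j' with k' <? j₁'
    ... | yes k'<j₁' = let (k , i≤k , k<j₁ , rk) = cover₁ k' i'≤k' k'<j₁'
                       in k , i≤k , <-≤-trans k<j₁ j₁≤j , rk
    ... | no k'≮j₁'  = let (k , j₁≤k , k<j , rk) = cover₂ k' (≮⇒≥ k'≮j₁') k'<j'
                       in k , ≤-trans i≤j₁ j₁≤k , k<j , rk

  since-then : ∀ {i i' j₁ j₁' j j'} → SinceAnswer R i i' j₁ j₁' → SinceAnswer R j₁ j₁' j j'
    → j ≤ j₁ → j₁ ≤ i → SinceAnswer R i i' j j'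
  since-then {i} {i'} {j₁' = j₁'} {j} {j'} (j₁'≤i' , _ , cover₁) (j'≤j₁' , rj , cover₂) j≤j₁ j₁≤i
    = ≤-trans j'≤j₁' j₁'≤i' , rj , cover
    where
    cover : ∀ k' → j' < k' → k' ≤ i' → Σ ℕ λ k → j < k × k ≤ i × R k k'
    cover k' j'<k' k'≤i' with k' ≤? j₁'
    ... | yes k'≤j₁' = let (k , j<k , k≤j₁ , rk) = cover₂ k' j'<k' k'≤j₁'
                       in k , j<k , ≤-trans k≤j₁ j₁≤i , rk
    ... | no k'≰j₁'  = let (k , j₁<k , k≤i , rk) = cover₁ k' (≰⇒> k'≰j₁') k'≤i'
                       in k , ≤-<-trans j≤j₁ j₁<k , k≤i , rk

  until-lockstep : ∀ {i i' d e} → e ≤ d → R (i + d) (i' + e)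
    → (∀ f → f < e → R (i + f) (i' + f)) → UntilAnswer R i i' (i + d) (i' + e)
  until-lockstep {i} {i'} {d} {e} e≤d rj mirror = m≤m+n i' e , rj , cover
    where
    cover : ∀ k' → i' ≤ k' → k' < i' + e → Σ ℕ λ k → i ≤ k × k < i + d × R k k'
    cover k' i'≤k' k'<j' with m≤n⇒∃[o]m+o≡n i'≤k'
    ... | f , refl = i + f , m≤m+n i f , +-monoʳ-< i (<-≤-trans f<e e≤d) , mirror f f<e
      where
      f<e : f < e
      f<e = +-cancelˡ-< i' f e k'<j'

  since-lockstep : ∀ {j j' d e} → e ≤ d → R j j'
    → (∀ f → 0 < f → f ≤ e → R (j + f) (j' + f)) → SinceAnswer R (j + d) (j' + e) j j'
  since-lockstep {j} {j'} {d} {e} e≤d rj mirror = m≤m+n j' e , rj , cover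
    where
    cover : ∀ k' → j' < k' → k' ≤ j' + e → Σ ℕ λ k → j < k × k ≤ j + d × R k k'
    cover k' j'<k' k'≤i' with m≤n⇒∃[o]m+o≡n (<⇒≤ j'<k')
    ... | f , refl = j + f , m<m+n j 0<f , +-monoʳ-≤ j (≤-trans f≤e e≤d) , mirror f 0<f f≤e
      where
      0<f : 0 < f
      0<f = +-cancelˡ-< j' 0 f (subst (_< j' + f) (sym (+-identityʳ j')) j'<k')
      f≤e : f ≤ e
      f≤e = +-cancelˡ-≤ j' f e k'≤i'

  until-diagonal : ∀ {i j} → (∀ x → i ≤ x → x ≤ j → R x x) → i ≤ j → UntilAnswer R i i j j
  until-diagonal {i} diag i≤j with m≤n⇒∃[o]m+o≡n i≤j
  ... | d , refl = until-lockstep ≤-refl (diag (i + d) (m≤m+n i d) ≤-refl)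
    (λ f f<d → diag (i + f) (m≤m+n i f) (+-monoʳ-≤ i (<⇒≤ f<d)))

  since-diagonal : ∀ {i j} → (∀ x → j ≤ x → x ≤ i → R x x) → j ≤ i → SinceAnswer R i i j j
  since-diagonal {j = j} diag j≤i with m≤n⇒∃[o]m+o≡n j≤i
  ... | d , refl = since-lockstep ≤-refl (diag j ≤-refl (m≤m+n j d))
    (λ f _ f≤d → diag (j + f) (m≤m+n j f) (+-monoʳ-≤ j f≤d))

  module _ {R' : ℕ → ℕ → Set} (R⊆R' : ∀ {x x'} → R x x' → R' x x') where

    until-map : ∀ {i i' j j'} → UntilAnswer R i i' j j' → UntilAnswer R' i i' j j'
    until-map (i'≤j' , rj , cover) = i'≤j' , R⊆R' rj ,
      λ k' i'≤k' k'<j' → let (k , i≤k , k<j , rk) = cover k' i'≤k' k'<j'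
                         in k , i≤k , k<j , R⊆R' rk

    since-map : ∀ {i i' j j'} → SinceAnswer R i i' j j' → SinceAnswer R' i i' j j'
    since-map (j'≤i' , rj , cover) = j'≤i' , R⊆R' rj ,
      λ k' j'<k' k'≤i' → let (k , j<k , k≤i , rk) = cover k' j'<k' k'≤i'
                         in k , j<k , k≤i , R⊆R' rk

record Game {AT : Set} (σ σ' : ωWord (Letter AT)) (R : ℕ → ℕ → ℕ → Set) : Set where
  field
    same-letter : ∀ {n i i'} → R n i i' → σ i ≡ σ' i'
    next   : ∀ {n i i'} → R (suc n) i i' → R n (suc i) (suc i')
    prev   : ∀ {n i i'} → R (suc n) (suc i) (suc i') → R n i i'
    origin : ∀ {n i} → R (suc n) i 0 → i ≡ 0
    until  : ∀ {n i i' j} → R (suc n) i i' → i ≤ j → Σ ℕ λ j' → UntilAnswer (R n) i i' j j'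
    since  : ∀ {n i i' j} → R (suc n) i i' → j ≤ i → Σ ℕ λ j' → SinceAnswer (R n) i i' j j'

-- One direction of adequacy; negation needs the converse game, so both
-- games and the conversions between their relations are carried along.
transfer : ∀ {AT} {σ σ' : ωWord (Letter AT)} {R R' : ℕ → ℕ → ℕ → Set}
  → Game σ σ' R → Game σ' σ R'
  → (∀ {n i i'} → R n i i' → R' n i' i) → (∀ {n i i'} → R' n i i' → R n i' i)
  → (φ : Formula AT) → ∀ {n i i'} → td φ ≤ n → R n i i' → σ , i ⊨ φ → σ' , i' ⊨ φ
transfer G G' f g (atom a) _ r h = trans (cong (λ l → l a) (sym (Game.same-letter G r))) h
transfer G G' f g (¬ᶠ φ) le r h = λ h' → h (transfer G' G g f φ le (f r) h')
transfer G G' f g (φ ∧ᶠ ψ) le r (hφ , hψ) =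
  transfer G G' f g φ (m⊔n≤o⇒m≤o (td φ) (td ψ) le) r hφ ,
  transfer G G' f g ψ (m⊔n≤o⇒n≤o (td φ) (td ψ) le) r hψ
transfer G G' f g (φ ∨ᶠ ψ) le r (inj₁ hφ) =
  inj₁ (transfer G G' f g φ (m⊔n≤o⇒m≤o (td φ) (td ψ) le) r hφ)
transfer G G' f g (φ ∨ᶠ ψ) le r (inj₂ hψ) =
  inj₂ (transfer G G' f g ψ (m⊔n≤o⇒n≤o (td φ) (td ψ) le) r hψ)
transfer G G' f g (X φ) {suc n} (s≤s le) r h = transfer G G' f g φ le (Game.next G r) h
transfer G G' f g (φ U ψ) {suc n} (s≤s le) r (j , i≤j , hψ , hφ) with Game.until G r i≤j
... | j' , i'≤j' , rj , cover =
  j' , i'≤j' , transfer G G' f g ψ (m⊔n≤o⇒n≤o (td φ) (td ψ) le) rj hψ ,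
  λ k' i'≤k' k'<j' → let (k , i≤k , k<j , rk) = cover k' i'≤k' k'<j' in
    transfer G G' f g φ (m⊔n≤o⇒m≤o (td φ) (td ψ) le) rk (hφ k i≤k k<j)
transfer G G' f g (X⁻¹ φ) {suc n} {zero} _ _ ()
transfer G G' f g (X⁻¹ φ) {suc n} {suc i} {zero} _ r _ with Game.origin G r
... | ()
transfer G G' f g (X⁻¹ φ) {suc n} {suc i} {suc i'} (s≤s le) r h =
  transfer G G' f g φ le (Game.prev G r) h
transfer G G' f g (φ S ψ) {suc n} (s≤s le) r (j , j≤i , hψ , hφ) with Game.since G r j≤i
... | j' , j'≤i' , rj , cover =
  j' , j'≤i' , transfer G G' f g ψ (m⊔n≤o⇒n≤o (td φ) (td ψ) le) rj hψ ,
  λ k' j'<k' k'≤i' → let (k , j<k , k≤i , rk) = cover k' j'<k' k'≤i' in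
    transfer G G' f g φ (m⊔n≤o⇒m≤o (td φ) (td ψ) le) rk (hφ k j<k k≤i)

adequacy : ∀ {AT} {σ σ' : ωWord (Letter AT)} {R R' : ℕ → ℕ → ℕ → Set}
  → Game σ σ' R → Game σ' σ R'
  → (∀ {n i i'} → R n i i' → R' n i' i) → (∀ {n i i'} → R' n i i' → R n i' i)
  → (φ : Formula AT) → ∀ {n i i'} → td φ ≤ n → R n i i' → (σ , i ⊨ φ) ⇔ (σ' , i' ⊨ φ)
adequacy G G' f g φ le r = mk⇔ (transfer G G' f g φ le r) (transfer G' G g f φ le (f r))

++ω-length : ∀ {A : Set} (u : List A) (w : ωWord A) x → (u ++ω w) (length u + x) ≡ w x
++ω-length []      w x = refl
++ω-length (a ∷ u) w x = ++ω-length u w x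

++ω-prefix : ∀ {A : Set} (u : List A) (w w' : ωWord A) {x}
  → x < length u → (u ++ω w) x ≡ (u ++ω w') x
++ω-prefix (a ∷ u) w w' {zero}  _         = refl
++ω-prefix (a ∷ u) w w' {suc x} (s≤s x<u) = ++ω-prefix u w w' x<u

++-++ω : ∀ {A : Set} (u v : List A) (w : ωWord A) x → ((u ++ v) ++ω w) x ≡ (u ++ω (v ++ω w)) x
++-++ω []      v w x       = refl
++-++ω (a ∷ u) v w zero    = refl
++-++ω (a ∷ u) v w (suc x) = ++-++ω u v w x

^ʷ-drop : ∀ {A : Set} (s : List A) (w : ωWord A) K D y
  → ((s ^ʷ (K + D)) ++ω w) (K * length s + y) ≡ ((s ^ʷ D) ++ω w) y
^ʷ-drop s w zero    D y = refl
^ʷ-drop s w (suc K) D y = begin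
  ((s ^ʷ suc (K + D)) ++ω w) (length s + K * length s + y)
    ≡⟨ cong ((s ^ʷ suc (K + D)) ++ω w) (+-assoc (length s) _ y) ⟩
  ((s ++ (s ^ʷ (K + D))) ++ω w) (length s + (K * length s + y))
    ≡⟨ ++-++ω s (s ^ʷ (K + D)) w _ ⟩
  (s ++ω ((s ^ʷ (K + D)) ++ω w)) (length s + (K * length s + y))
    ≡⟨ ++ω-length s _ _ ⟩
  ((s ^ʷ (K + D)) ++ω w) (K * length s + y)
    ≡⟨ ^ʷ-drop s w K D y ⟩
  ((s ^ʷ D) ++ω w) y
    ∎
  where open ≡-Reasoning

^ʷ-periodic : ∀ {A : Set} (s : List A) .{{_ : NonZero (length s)}} (w : ωWord A) M x
  → x < M * length s → ((s ^ʷ M) ++ω w) x ≡ (s ++ω w) (x % length s)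
^ʷ-periodic s w M x x<Mp with m≤n⇒∃[o]m+o≡n (m<n*o⇒m/o<n {x} {M} {length s} x<Mp)
... | D , refl = begin
  ((s ^ʷ (suc q + D)) ++ω w) x
    ≡⟨ cong (λ m → ((s ^ʷ m) ++ω w) x) (sym (+-suc q D)) ⟩
  ((s ^ʷ (q + suc D)) ++ω w) x
    ≡⟨ cong ((s ^ʷ (q + suc D)) ++ω w) x≡qp+r ⟩
  ((s ^ʷ (q + suc D)) ++ω w) (q * length s + r)
    ≡⟨ ^ʷ-drop s w q (suc D) r ⟩
  ((s ++ (s ^ʷ D)) ++ω w) r
    ≡⟨ ++-++ω s (s ^ʷ D) w r ⟩
  (s ++ω ((s ^ʷ D) ++ω w)) r
    ≡⟨ ++ω-prefix s _ w (m%n<n x (length s)) ⟩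
  (s ++ω w) r
    ∎
  where
  open ≡-Reasoning
  q r : ℕ
  q = x / length s
  r = x % length s
  x≡qp+r : x ≡ q * length s + r
  x≡qp+r = trans (m≡m%n+[m/n]*n x (length s)) (+-comm r (q * length s))

-- Positions of σ₁ s^M σ₂ with L = |σ₁| and p = |s| = suc p₀.
module Zones (L p₀ : ℕ) where

  p : ℕ
  p = suc p₀

  open Congruence p public

  -- blk k is where the (k+1)-st copy of s starts.
  blk : ℕ → ℕ
  blk k = L + k * p

  blk-suc : ∀ k → blk (suc k) ≡ blk k + p
  blk-suc k = shift L k p
    where
    shift : ∀ L k q → L + (q + k * q) ≡ L + k * q + q
    shift = solve-∀

  blk-mono : ∀ {m k} → m ≤ k → blk m ≤ blk k
  blk-mono m≤k = +-monoʳ-≤ L (*-monoˡ-≤ p m≤k)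

  blk-gap : ∀ {m k} → m < k → blk m + p ≤ blk k
  blk-gap {m} {k} m<k = subst (_≤ blk k) (blk-suc m) (blk-mono m<k)

  blk-< : ∀ {m k} → m < k → blk m < blk k
  blk-< {m} m<k = <-≤-trans (m<m+n (blk m) (s≤s z≤n)) (blk-gap m<k)

  <-blk-suc : ∀ {x} k → x < blk k + p → x < blk (suc k)
  <-blk-suc {x} k = subst (x <_) (sym (blk-suc k))

  0<blk-suc : ∀ k → 0 < blk (suc k)
  0<blk-suc k = ≤-trans (s≤s z≤n) (subst (p ≤_) (sym (blk-suc k)) (m≤n+m p (blk k)))

  L≤blk : ∀ k → L ≤ blk k
  L≤blk k = m≤m+n L (k * p)

  blk≋blk : ∀ k k' → blk k ≋ blk k'
  blk≋blk k k' = k' , k , exchange L k k' p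
    where
    exchange : ∀ L k k' p → L + k * p + k' * p ≡ L + k' * p + k * p
    exchange = solve-∀

  representative : ∀ m {k'} → L ≤ k' → Σ ℕ λ k → blk m ≤ k × k < blk m + p × k ≋ k'
  representative m L≤k' with m≤n⇒∃[o]m+o≡n L≤k'
  ... | x , refl = blk m + x % p , m≤m+n (blk m) (x % p) , +-monoʳ-< (blk m) (m%n<n x p) , congruent
    where
    exchange : ∀ L m p r q → L + m * p + r + q * p ≡ L + (r + q * p) + m * p
    exchange = solve-∀
    congruent : blk m + x % p ≋ L + x
    congruent = x / p , m ,
      trans (exchange L m p (x % p) (x / p)) (cong (λ t → L + t + m * p) (sym (m≡m%n+[m/n]*n x p)))

  -- The level-n relation between σ_M and σ_M', where M = K + n and M' = K' + n:
  -- left zones below blk n, middle zones up to blk K (resp. blk K'), and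
  -- right zones from there on.
  data Match (n K K' : ℕ) : ℕ → ℕ → Set where
    left  : ∀ {i} → i < blk n → Match n K K' i i
    right : ∀ y → Match n K K' (blk K + y) (blk K' + y)
    mid   : ∀ {i i'} → blk n ≤ i → i < blk K → blk n ≤ i' → i' < blk K' → i ≋ i' → Match n K K' i i'

  swap : ∀ {n K K' i i'} → Match n K K' i i' → Match n K' K i' i
  swap (left i<n)              = left i<n
  swap (right y)               = right y
  swap (mid lo hi lo' hi' i≋i') = mid lo' hi' lo hi (≋-sym i≋i')

  diagonal : ∀ {n K K' x} → x < blk K → x < blk K' → Match n K K' x x
  diagonal {n} {x = x} x<K x<K' with x <? blk n
  ... | yes x<n = left x<n
  ... | no x≮n  = mid (≮⇒≥ x≮n) x<K (≮⇒≥ x≮n) x<K' ≋-refl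

  -- Equal offsets from blk K and blk K' are matched once one more block is
  -- counted in the middle zone: in the middle zone if the offset is below
  -- p, in the right zone otherwise.
  align : ∀ {n K K'} → n ≤ K → n ≤ K' → ∀ z → Match n (suc K) (suc K') (blk K + z) (blk K' + z)
  align {n} {K} {K'} n≤K n≤K' z with z <? p
  ... | yes z<p = mid (above n≤K) (below K) (above n≤K') (below K') (≋-+ʳ z (blk≋blk K K'))
    where
    above : ∀ {k} → n ≤ k → blk n ≤ blk k + z
    above n≤k = ≤-trans (blk-mono n≤k) (m≤m+n _ z)
    below : ∀ k → blk k + z < blk (suc k)
    below k = <-blk-suc k (+-monoʳ-< (blk k) z<p)
  ... | no z≮p with m≤n⇒∃[o]m+o≡n (≮⇒≥ z≮p)
  ...   | y , refl = subst₂ (Match n (suc K) (suc K')) (next-block K) (next-block K') (right y)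
    where
    next-block : ∀ k → blk (suc k) + y ≡ blk k + (p + y)
    next-block k = trans (cong (_+ y) (blk-suc k)) (+-assoc (blk k) p y)

  -- The moves from level n+1 (blocks K, K') to level n (blocks K+1, K'+1),
  -- provided the zones of level n+1 do not overlap.
  module Descent {n K K' : ℕ} (n+1≤K : suc n ≤ K) (n+1≤K' : suc n ≤ K') where

    R : ℕ → ℕ → Set
    R = Match n (suc K) (suc K')

    n≤K : n ≤ K
    n≤K = ≤-trans (n≤1+n n) n+1≤K

    n≤K' : n ≤ K'
    n≤K' = ≤-trans (n≤1+n n) n+1≤K'

    lower : ∀ {x} → blk (suc n) ≤ x → blk n ≤ x
    lower = ≤-trans (blk-mono (n≤1+n n))

    p≤ : ∀ {x} → blk (suc n) ≤ x → p ≤ x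
    p≤ = ≤-trans (subst (p ≤_) (sym (blk-suc n)) (m≤n+m p (blk n)))

    low-diagonal : ∀ {x} → x ≤ blk (suc n) → R x x
    low-diagonal x≤ =
      diagonal (≤-<-trans x≤ (blk-< (s≤s n+1≤K))) (≤-<-trans x≤ (blk-< (s≤s n+1≤K')))

    middle : ∀ {x x'} → blk n ≤ x → x < blk K + p → blk n ≤ x' → x' < blk K' + p → x ≋ x' → R x x'
    middle lo hi lo' hi' x≋x' = mid lo (<-blk-suc K hi) lo' (<-blk-suc K' hi') x≋x'

    aligned : ∀ y f → R (blk K + y + f) (blk K' + y + f)
    aligned y f =
      subst₂ R (sym (+-assoc (blk K) y f)) (sym (+-assoc (blk K') y f)) (align n≤K n≤K' (y + f))

    step : ∀ {i i'} → Match (suc n) K K' i i' → R (suc i) (suc i')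
    step (left i<)                = low-diagonal i<
    step (right y)                =
      subst₂ R (+-suc (blk K) y) (+-suc (blk K') y) (align n≤K n≤K' (suc y))
    step (mid lo hi lo' hi' i≋i') =
      mid (≤-trans (lower lo) (n≤1+n _)) (≤-<-trans hi (blk-< (n<1+n K)))
          (≤-trans (lower lo') (n≤1+n _)) (≤-<-trans hi' (blk-< (n<1+n K'))) (≋-+ˡ 1 i≋i')

    before-right : ∀ {k x} → n < k → blk k + 0 ≡ suc x → blk n ≤ x × x < blk k + p
    before-right {k} {x} n<k eq =
      s≤s⁻¹ (subst (suc (blk n) ≤_) (trans (sym (+-identityʳ (blk k))) eq)
                   (≤-trans (m<m+n (blk n) (s≤s z≤n)) (blk-gap n<k))) ,
      subst (_≤ blk k + p) eq (+-monoʳ-≤ (blk k) z≤n)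

    unstep : ∀ {j j' i i'} → Match (suc n) K K' j j' → j ≡ suc i → j' ≡ suc i' → R i i'
    unstep (left j<) refl refl = low-diagonal (≤-trans (n≤1+n _) (<⇒≤ j<))
    unstep (right zero) eq eq' =
      let (lo , hi) = before-right n+1≤K eq
          (lo' , hi') = before-right n+1≤K' eq'
      in middle lo hi lo' hi' (≋-cancelˡ 1 (subst₂ _≋_ eq eq' (≋-+ʳ 0 (blk≋blk K K'))))
    unstep (right (suc y)) eq eq' = subst₂ R (predecessor eq) (predecessor eq') (align n≤K n≤K' y)
      where
      predecessor : ∀ {k x} → k + suc y ≡ suc x → k + y ≡ x
      predecessor {k} eq = suc-injective (trans (sym (+-suc k y)) eq)
    unstep (mid lo hi lo' hi' i≋i') refl refl =
      mid (before lo) (<-trans (n<1+n _) (<-trans hi (blk-< (n<1+n K))))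
          (before lo') (<-trans (n<1+n _) (<-trans hi' (blk-< (n<1+n K')))) (≋-cancelˡ 1 i≋i')
      where
      before : ∀ {x} → blk (suc n) ≤ suc x → blk n ≤ x
      before {x} lo = +-cancelʳ-≤ p (blk n) x
        (≤-trans (subst (_≤ suc x) (blk-suc n) lo) (m<m+n x (s≤s z≤n)))

    origin : ∀ {i i'} → Match (suc n) K K' i i' → i' ≡ 0 → i ≡ 0
    origin (left _) i≡0 = i≡0
    origin (right y) eq = ⊥-elim (<-irrefl refl (subst (0 <_) eq
      (≤-trans (0<blk-suc n) (≤-trans (blk-mono n+1≤K') (m≤m+n _ y)))))
    origin (mid _ _ lo' _ _) refl = ⊥-elim (<-irrefl refl (<-≤-trans (0<blk-suc n) lo'))

    until-right : ∀ y {j} → blk K + y ≤ j → Σ ℕ λ j' → UntilAnswer R (blk K + y) (blk K' + y) j j'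
    until-right y le with m≤n⇒∃[o]m+o≡n le
    ... | d , refl = blk K' + y + d , until-lockstep ≤-refl (aligned y d) (λ f _ → aligned y f)

    -- Leaving the middle zone for the right zone of level n: each middle
    -- position passed in σ' has a congruent copy in the last middle block of σ.
    enter-right : ∀ {i i'} → i ≤ blk K → blk n ≤ i' → i' ≤ blk K'
      → UntilAnswer R i i' (blk K + p) (blk K' + p)
    enter-right {i} {i'} i≤ lo' i'≤ = ≤-trans i'≤ (m≤m+n _ p) , align n≤K n≤K' p , cover
      where
      cover : ∀ k' → i' ≤ k' → k' < blk K' + p → Σ ℕ λ k → i ≤ k × k < blk K + p × R k k'
      cover k' i'≤k' k'< with representative K (≤-trans (L≤blk n) (≤-trans lo' i'≤k'))
      ... | k , K≤k , k< , k≋k' =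
        k , ≤-trans i≤ K≤k , k< , middle (≤-trans (blk-mono n≤K) K≤k) k< (≤-trans lo' i'≤k') k'< k≋k'

    -- The move of U from congruent middle positions: stay in lockstep modulo p
    -- while the target is in the middle zone, otherwise enter the right zone.
    until-middle : ∀ {i i' j} → blk n ≤ i → i ≤ blk K → blk n ≤ i' → i' ≤ blk K' → i ≋ i'
      → i ≤ j → Σ ℕ λ j' → UntilAnswer R i i' j j'
    until-middle {i} {i'} {j} lo hi lo' hi' i≋i' i≤j with j <? blk K + p
    ... | no j≮ with until-right p (≮⇒≥ j≮)
    ...   | j' , answer =
      j' , until-then (enter-right hi lo' hi') answer (≤-trans hi (m≤m+n _ p)) (≮⇒≥ j≮)
    until-middle {i} {i'} {j} lo hi lo' hi' i≋i' i≤j | yes j< with m≤n⇒∃[o]m+o≡n i≤j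
    ... | d , refl = i' + d % p , until-lockstep (m%n≤m d p) target shifted
      where
      j'< : i' + d % p < blk K' + p
      j'< = +-mono-≤-< hi' (m%n<n d p)
      target : R (i + d) (i' + d % p)
      target = middle (≤-trans lo (m≤m+n i d)) j< (≤-trans lo' (m≤m+n i' _)) j'<
        (≋-trans (≋-+ʳ d i≋i') (≋-+ˡ i' (≋-sym (%-≋ d))))
      shifted : ∀ f → f < d % p → R (i + f) (i' + f)
      shifted f f< =
        middle (≤-trans lo (m≤m+n i f)) (≤-<-trans (+-monoʳ-≤ i (≤-trans (<⇒≤ f<) (m%n≤m d p))) j<)
               (≤-trans lo' (m≤m+n i' f)) (<-trans (+-monoʳ-< i' f<) j'<) (≋-+ʳ f i≋i')

    until-move : ∀ {i i' j} → Match (suc n) K K' i i' → i ≤ j → Σ ℕ λ j' → UntilAnswer R i i' j j'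
    until-move {j = j} (left i<) i≤j with j ≤? blk (suc n)
    ... | yes j≤ = j , until-diagonal (λ x _ x≤j → low-diagonal (≤-trans x≤j j≤)) i≤j
    ... | no j≰ with until-middle (lower ≤-refl) (blk-mono n+1≤K) (lower ≤-refl) (blk-mono n+1≤K')
                                  ≋-refl (<⇒≤ (≰⇒> j≰))
    ...   | j' , answer =
      j' , until-then (until-diagonal (λ x _ → low-diagonal) (<⇒≤ i<)) answer (<⇒≤ i<) (<⇒≤ (≰⇒> j≰))
    until-move (right y) i≤j = until-right y i≤j
    until-move (mid lo hi lo' hi' i≋i') i≤j =
      until-middle (lower lo) (<⇒≤ hi) (lower lo') (<⇒≤ hi') i≋i' i≤j

    since-right : ∀ y {z} → z ≤ y → SinceAnswer R (blk K + y) (blk K' + y) (blk K + z) (blk K' + z)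
    since-right y {z} z≤y with m≤n⇒∃[o]m+o≡n z≤y
    ... | d , refl = subst₂ (λ x x' → SinceAnswer R x x' (blk K + z) (blk K' + z))
      (+-assoc (blk K) z d) (+-assoc (blk K') z d)
      (since-lockstep ≤-refl (align n≤K n≤K' z) (λ f _ _ → aligned z f))

    -- The move of S from the middle to the left zone of level n: the target
    -- is copied, and the middle positions passed in σ' get congruent copies
    -- in the first middle block of σ.
    since-to-left : ∀ {i i' j} → blk (suc n) ≤ i → blk (suc n) ≤ i' → i' < blk K' + p → j < blk n
      → SinceAnswer R i i' j j
    since-to-left {i} {i'} {j} lo lo' hi' j<n = ≤-trans (<⇒≤ j<n) (lower lo') , left j<n , cover
      where
      cover : ∀ k' → j < k' → k' ≤ i' → Σ ℕ λ k → j < k × k ≤ i × R k k'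
      cover k' j<k' k'≤i' with k' ≤? blk (suc n)
      ... | yes k'≤ = k' , j<k' , ≤-trans k'≤ lo , low-diagonal k'≤
      ... | no k'≰ with representative n (≤-trans (L≤blk n) (lower (<⇒≤ (≰⇒> k'≰))))
      ...   | k , n≤k , k< , k≋k' =
        k , <-≤-trans j<n n≤k , <⇒≤ (<-≤-trans k< (subst (_≤ i) (blk-suc n) lo)) ,
        middle n≤k (<-≤-trans k< (+-monoˡ-≤ p (blk-mono n≤K)))
               (lower (<⇒≤ (≰⇒> k'≰))) (≤-<-trans k'≤i' hi') k≋k'

    -- The move of S from congruent middle positions: stay in lockstep modulo
    -- p while the target is in the middle zone of level n.
    since-middle : ∀ {i i' j} → blk (suc n) ≤ i → i < blk K + p → blk (suc n) ≤ i' → i' < blk K' + p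
      → i ≋ i' → j ≤ i → Σ ℕ λ j' → SinceAnswer R i i' j j'
    since-middle {i} {i'} {j} lo hi lo' hi' i≋i' j≤i with blk n ≤? j
    ... | no j≱ = j , since-to-left lo lo' hi' (≰⇒> j≱)
    ... | yes n≤j with m≤n⇒∃[o]m+o≡n j≤i
    ...   | d , refl with split-off (≤-trans (<⇒≤ (m%n<n d p)) (p≤ lo'))
    ...     | j' , refl = j' , since-lockstep (m%n≤m d p) source shifted
      where
      n≤j' : blk n ≤ j'
      n≤j' = +-cancelʳ-≤ p (blk n) j'
        (≤-trans (subst (_≤ j' + d % p) (blk-suc n) lo') (+-monoʳ-≤ j' (<⇒≤ (m%n<n d p))))
      j≋j' : j ≋ j'
      j≋j' = ≋-cancelʳ (d % p) (≋-trans (≋-+ˡ j (%-≋ d)) i≋i')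
      source : R j j'
      source = middle n≤j (≤-<-trans (m≤m+n j d) hi) n≤j' (≤-<-trans (m≤m+n j' _) hi') j≋j'
      shifted : ∀ f → 0 < f → f ≤ d % p → R (j + f) (j' + f)
      shifted f _ f≤ =
        middle (≤-trans n≤j (m≤m+n j f)) (≤-<-trans (+-monoʳ-≤ j (≤-trans f≤ (m%n≤m d p))) hi)
               (≤-trans n≤j' (m≤m+n j' f)) (≤-<-trans (+-monoʳ-≤ j' f≤) hi') (≋-+ʳ f j≋j')

    -- The move of S from the right zone to a target before it: first back to
    -- the start of the right zone, then on from that boundary pair, which
    -- is a congruent middle pair of level n.
    since-past-right : ∀ y {j} → j < blk K → Σ ℕ λ j' → SinceAnswer R (blk K + y) (blk K' + y) j j'
    since-past-right y {j} j<K =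
      let (j' , answer) = since-middle (boundary n+1≤K) (within K) (boundary n+1≤K') (within K')
                                       (≋-+ʳ 0 (blk≋blk K K')) j≤K
      in j' , since-then (since-right y z≤n) answer j≤K (+-monoʳ-≤ (blk K) z≤n)
      where
      boundary : ∀ {k} → suc n ≤ k → blk (suc n) ≤ blk k + 0
      boundary n+1≤k = ≤-trans (blk-mono n+1≤k) (m≤m+n _ 0)
      within : ∀ k → blk k + 0 < blk k + p
      within k = +-monoʳ-< (blk k) (s≤s z≤n)
      j≤K : j ≤ blk K + 0
      j≤K = ≤-trans (<⇒≤ j<K) (m≤m+n _ 0)

    since-move : ∀ {i i' j} → Match (suc n) K K' i i' → j ≤ i → Σ ℕ λ j' → SinceAnswer R i i' j j'
    since-move {j = j} (left i<) j≤i =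
      j , since-diagonal (λ x _ x≤i → low-diagonal (≤-trans x≤i (<⇒≤ i<))) j≤i
    since-move {j = j} (right y) j≤i with blk K ≤? j
    ... | no j≱ = since-past-right y (≰⇒> j≱)
    ... | yes K≤j with m≤n⇒∃[o]m+o≡n K≤j
    ...   | z , refl = blk K' + z , since-right y (+-cancelˡ-≤ (blk K) z y j≤i)
    since-move (mid lo hi lo' hi' i≋i') j≤i =
      since-middle lo (<-trans hi (m<m+n (blk K) (s≤s z≤n))) lo' (<-trans hi' (m<m+n (blk K') (s≤s z≤n)))
                   i≋i' j≤i

module Pumping {AT : Set} (σ₁ : List (Letter AT)) (c : Letter AT) (cs : List (Letter AT))
               (σ₂ : ωWord (Letter AT)) where

  s : List (Letter AT)
  s = c ∷ cs

  open Zones (length σ₁) (length cs) public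

  W : ℕ → ωWord (Letter AT)
  W M = σ₁ ++ω ((s ^ʷ M) ++ω σ₂)

  W-prefix : ∀ M M' {x} → x < length σ₁ → W M x ≡ W M' x
  W-prefix M M' = ++ω-prefix σ₁ _ _

  W-periodic : ∀ M x → x < M * p → W M (length σ₁ + x) ≡ (s ++ω σ₂) (x % p)
  W-periodic M x x< = trans (++ω-length σ₁ _ x) (^ʷ-periodic s σ₂ M x x<)

  W-right : ∀ K n y → W (K + n) (blk K + y) ≡ ((s ^ʷ n) ++ω σ₂) y
  W-right K n y = begin
    W (K + n) (blk K + y)               ≡⟨ cong (W (K + n)) (+-assoc (length σ₁) (K * p) y) ⟩
    W (K + n) (length σ₁ + (K * p + y)) ≡⟨ ++ω-length σ₁ _ _ ⟩
    ((s ^ʷ (K + n)) ++ω σ₂) (K * p + y) ≡⟨ ^ʷ-drop s σ₂ K n y ⟩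
    ((s ^ʷ n) ++ω σ₂) y                 ∎
    where open ≡-Reasoning

  same-letter : ∀ {n K K' M M' i i'} → Match n K K' i i' → K + n ≡ M → K' + n ≡ M' → W M i ≡ W M' i'
  same-letter {n} {K} {K'} {i = i} (left i<n) refl refl with i <? length σ₁
  ... | yes i<L = W-prefix (K + n) (K' + n) i<L
  ... | no i≮L with m≤n⇒∃[o]m+o≡n (≮⇒≥ i≮L)
  ...   | x , refl =
    trans (W-periodic (K + n) x (in-prefix K)) (sym (W-periodic (K' + n) x (in-prefix K')))
    where
    in-prefix : ∀ k → x < (k + n) * p
    in-prefix k = <-≤-trans (+-cancelˡ-< (length σ₁) x (n * p) i<n) (*-monoˡ-≤ p (m≤n+m n k))
  same-letter {n} {K} {K'} (right y) refl refl = trans (W-right K n y) (sym (W-right K' n y))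
  same-letter {n} {K} {K'} (mid lo hi lo' hi' i≋i') refl refl
    with m≤n⇒∃[o]m+o≡n (≤-trans (L≤blk n) lo) | m≤n⇒∃[o]m+o≡n (≤-trans (L≤blk n) lo')
  ... | x , refl | x' , refl =
    trans (W-periodic (K + n) x (in-middle {K} hi))
      (trans (cong (s ++ω σ₂) (≋⇒%≡ (≋-cancelˡ (length σ₁) i≋i')))
             (sym (W-periodic (K' + n) x' (in-middle {K'} hi'))))
    where
    in-middle : ∀ {k z} → length σ₁ + z < blk k → z < (k + n) * p
    in-middle {k} {z} z< = <-≤-trans (+-cancelˡ-< (length σ₁) z (k * p) z<) (*-monoˡ-≤ p (m≤m+n k n))

  -- The game relation at level n: the zone matching with M = K + n and
  -- M' = K' + n, where the left zones end before the right zones begin.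
  data Level (M M' n i i' : ℕ) : Set where
    level : ∀ {K K'} → K + n ≡ M → K' + n ≡ M' → n ≤ K → n ≤ K' → Match n K K' i i'
      → Level M M' n i i'

  Level-swap : ∀ {M M' n i i'} → Level M M' n i i' → Level M' M n i' i
  Level-swap (level eq eq' n≤K n≤K' m) = level eq' eq n≤K' n≤K (swap m)

  game : ∀ M M' → Game (W M) (W M') (Level M M')
  game M M' = record
    { same-letter = λ { (level eq eq' _ _ m) → same-letter m eq eq' }
    ; next   = λ { (level eq eq' b b' m) → descend eq eq' b b' (Descent.step b b' m) }
    ; prev   = λ { (level eq eq' b b' m) → descend eq eq' b b' (Descent.unstep b b' m refl refl) }
    ; origin = λ { (level _ _ b b' m) → Descent.origin b b' m refl }
    ; until  = λ { (level eq eq' b b' m) i≤j →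
        let (j' , answer) = Descent.until-move b b' m i≤j
        in j' , until-map (descend eq eq' b b') answer }
    ; since  = λ { (level eq eq' b b' m) j≤i →
        let (j' , answer) = Descent.since-move b b' m j≤i
        in j' , since-map (descend eq eq' b b') answer }
    }
    where
    descend : ∀ {n K K' x x'} → K + suc n ≡ M → K' + suc n ≡ M' → suc n ≤ K → suc n ≤ K'
      → Match n (suc K) (suc K') x x' → Level M M' n x x'
    descend {n} {K} {K'} eq eq' b b' =
      level (trans (sym (+-suc K n)) eq) (trans (sym (+-suc K' n)) eq')
            (<⇒≤ (m≤n⇒m≤1+n b)) (<⇒≤ (m≤n⇒m≤1+n b'))

  -- Offsets into the right zones agree when the positions agree in the
  -- sense of case (2) of ≡_N.
  right-offsets : ∀ {K K' N M M' y y'} → K + N ≡ M → K' + N ≡ M'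
    → blk K + y + M' * p ≡ blk K' + y' + M * p → y ≡ y'
  right-offsets {K} {K'} {N} {y = y} {y'} refl refl eq = +-cancelʳ-≡ total y y' (begin
    y + total                     ≡⟨ sym (regroupˡ (length σ₁) K K' N p y) ⟩
    blk K + y + (K' + N) * p      ≡⟨ eq ⟩
    blk K' + y' + (K + N) * p     ≡⟨ regroupʳ (length σ₁) K K' N p y' ⟩
    y' + total                    ∎)
    where
    open ≡-Reasoning
    total : ℕ
    total = length σ₁ + (K + K' + N) * p
    regroupˡ : ∀ L K K' N p y → L + K * p + y + (K' + N) * p ≡ y + (L + (K + K' + N) * p)
    regroupˡ = solve-∀
    regroupʳ : ∀ L K K' N p y → L + K' * p + y + (K + N) * p ≡ y + (L + (K + K' + N) * p)
    regroupʳ = solve-∀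

  equiv⇒match : ∀ {M M' N i i'} → N ≤ M → N ≤ M' → Equiv σ₁ s M M' N i i'
    → Match N (M ∸ N) (M' ∸ N) i i'
  equiv⇒match _ _ (_ , inj₁ (i< , _ , refl)) = left i<
  equiv⇒match {M} {M'} {N} N≤M N≤M' (_ , inj₂ (inj₁ (lo , lo' , eq)))
    with m≤n⇒∃[o]m+o≡n lo | m≤n⇒∃[o]m+o≡n lo'
  ... | y , refl | y' , refl
    with right-offsets {M ∸ N} {M' ∸ N} {N} (m∸n+n≡m N≤M) (m∸n+n≡m N≤M') eq
  ...   | refl = right y
  equiv⇒match _ _ (_ , inj₂ (inj₂ (lo , hi , lo' , hi' , p∣))) = mid lo hi lo' hi' (∣-∣⇒≋ p∣)

  start : ∀ {M M' N i i'} → N + N ≤ M → N + N ≤ M' → Equiv σ₁ s M M' N i i' → Level M M' N i i'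
  start {N = N} 2N≤M 2N≤M' equiv =
    level (m∸n+n≡m (m+n≤o⇒n≤o N 2N≤M)) (m∸n+n≡m (m+n≤o⇒n≤o N 2N≤M'))
          (m+n≤o⇒m≤o∸n N 2N≤M) (m+n≤o⇒m≤o∸n N 2N≤M')
          (equiv⇒match (m+n≤o⇒n≤o N 2N≤M) (m+n≤o⇒n≤o N 2N≤M') equiv)

-- The hypothesis M ≥ 2N+1 of the theorem leaves room for the outer zones.
2N+1≤⇒N+N≤ : ∀ {N M} → 2 * N + 1 ≤ M → N + N ≤ M
2N+1≤⇒N+N≤ {N} {M} 2N+1≤M = ≤-trans (m≤m+n (N + N) 1) (subst (_≤ M) (double N) 2N+1≤M)
  where
  double : ∀ N → 2 * N + 1 ≡ N + N + 1
  double = solve-∀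

theorem2 : {AT : Set} (σ₁ s : List (Letter AT)) (σ₂ : ωWord (Letter AT))
    → s ≢ []
    → (M M' N i i' : ℕ)
    → 2 ≤ N → 2 * N + 1 ≤ M → 2 * N + 1 ≤ M'
    → Equiv σ₁ s M M' N i i'
    → (φ : Formula AT) → td φ ≤ N
    → ((σ₁ ++ω ((s ^ʷ M) ++ω σ₂)) , i ⊨ φ) ⇔ ((σ₁ ++ω ((s ^ʷ M') ++ω σ₂)) , i' ⊨ φ)
theorem2 σ₁ []       σ₂ s≢[] _ _ _ _ _ _ _ _ _ _ _ = ⊥-elim (s≢[] refl)
theorem2 σ₁ (c ∷ cs) σ₂ _ M M' N i i' _ 2N+1≤M 2N+1≤M' equiv φ td≤N =
  adequacy (game M M') (game M' M) Level-swap Level-swap φ td≤N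
    (start (2N+1≤⇒N+N≤ {N} 2N+1≤M) (2N+1≤⇒N+N≤ {N} 2N+1≤M') equiv)
  where open Pumping σ₁ c cs σ₂
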